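{- Let $k \geq 1$ and $n \geq 2k+2$. Then the power of a cycle $C_n^k$ has biclique-chromatic number at most $3$.
   Context: For $k \geq 1$, the power of a cycle $C_n^k$ is the simple graph with vertex set $\{v_0,\dots,v_{n-1}\}$ in which $v_i v_j$ ($i\neq j$) is an edge if and only if $\min\{(j-i) \bmod n, (i-j) \bmod n\} \leq k$. A biclique of a graph is a maximal (under inclusion) set of vertices inducing a complete bipartite subgraph with at least one edge. A biclique-colouring is an assignment of colours to the vertices such that no biclique is monochromatic; the biclique-chromatic number is the least $c$ such that a biclique-colouring with at most $c$ colours exists. -}

module Defs where

open import Data.Nat using (ℕ; zero; suc; _+_; _∸_; _≤_; _⊓_; NonZero)
open import Data.Nat.DivMod using (_%_)
open import Data.Fin using (Fin; toℕ)
open import Data.Bool using (Bool; true; false; T)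
open import Data.Product using (Σ; ∃; ∃-syntax; _×_; _,_)
open import Relation.Binary.PropositionalEquality using (_≡_; _≢_)
open import Relation.Nullary using (¬_)

Graph : ℕ → Set₁
Graph n = Fin n → Fin n → Set

CyclePower : (n k : ℕ) → .{{NonZero n}} → Graph n
CyclePower n k i j =
  (i ≢ j) × (((toℕ j + n ∸ toℕ i) % n) ⊓ ((toℕ i + n ∸ toℕ j) % n) ≤ k)

VSet : ℕ → Set
VSet n = Fin n → Bool

_∈_ : ∀ {n} → Fin n → VSet n → Set
v ∈ S = T (S v)

_⊆_ : ∀ {n} → VSet n → VSet n → Set
S ⊆ S' = ∀ v → v ∈ S → v ∈ S'

-- S induces a complete bipartite subgraph with at least one edge:
-- S splits into two nonempty independent parts (side v ≡ true / false)
-- with every pair across the parts adjacent.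
InducesCompleteBipartite : ∀ {n} → Graph n → VSet n → Set
InducesCompleteBipartite {n} G S =
  Σ (Fin n → Bool) λ side →
    (∃[ a ] (a ∈ S × side a ≡ true)) ×
    (∃[ b ] (b ∈ S × side b ≡ false)) ×
    (∀ u v → u ∈ S → v ∈ S → side u ≡ side v → ¬ G u v) ×
    (∀ u v → u ∈ S → v ∈ S → side u ≢ side v → G u v)

Biclique : ∀ {n} → Graph n → VSet n → Set
Biclique {n} G S =
  InducesCompleteBipartite G S ×
  (∀ S' → S ⊆ S' → InducesCompleteBipartite G S' → S' ⊆ S)

IsBicliqueColouring : ∀ {n c} → Graph n → (Fin n → Fin c) → Set
IsBicliqueColouring {n} G col =
  ∀ S → Biclique G S → ∃[ u ] ∃[ v ] (u ∈ S × v ∈ S × col u ≢ col v)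

BicliqueChromatic≤ : ∀ {n} → Graph n → ℕ → Set
BicliqueChromatic≤ {n} G c = Σ (Fin n → Fin c) λ col → IsBicliqueColouring G col

-- Colour v_i with 2 if i ≥ n − k and with the parity of ⌊i/k⌋ otherwise. Two vertices of the
-- same colour are then adjacent exactly when they lie in the same block (the last k vertices, or
-- the vertices below n − k with a common quotient by k), so each colour class induces a disjoint
-- union of cliques. A monochromatic complete bipartite set therefore contains no
-- induced path on three vertices, i.e. it is a single edge uv. Since n ≥ 2k + 2, some vertex is
-- adjacent to u but not to v, and adding it gives a strictly larger complete bipartite set, so a
-- monochromatic edge is never a biclique.

module Submission where

open import Data.Bool using (true; false; _∨_)
open import Data.Empty using (⊥-elim)
open import Data.Fin using (Fin; zero; suc; toℕ; fromℕ<)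
open import Data.Fin.Properties using (toℕ<n; toℕ-injective; toℕ-fromℕ<; any?)
  renaming (_≟_ to _≟ᶠ_)
open import Data.Maybe using (Maybe; just; nothing)
open import Data.Maybe.Properties using (just-injective)
open import Data.Nat hiding (parity)
open import Data.Nat.DivMod
open import Data.Nat.Properties
open import Data.Nat.Tactic.RingSolver using (solve-∀)
open import Data.Product using (∃-syntax; ∃₂; _×_; _,_)
open import Data.Sum using (_⊎_; inj₁; inj₂; [_,_]′)
open import Function using (_∘_; id; case_of_)
open import Relation.Binary using (tri<; tri≈; tri>)
open import Relation.Binary.PropositionalEquality
open import Relation.Nullary using (¬_; Dec; does; yes; no; contradiction)
open import Relation.Nullary.Decidable using (dec-true; dec-false; decidable-stable; T?; _×-dec_; ¬?)

open import Defs

module _ {n : ℕ} {G : Graph n} where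

  completeBipartite⇒edge :
    ∀ {S} → InducesCompleteBipartite G S →
    (∀ {u v w} → u ∈ S → v ∈ S → w ∈ S → G u v → G v w → u ≢ w → G u w) →
    ∃₂ λ a b → a ∈ S × b ∈ S × G a b × (∀ c → c ∈ S → c ≡ a ⊎ c ≡ b)
  completeBipartite⇒edge {S} (side , (a , a∈ , a↑) , (b , b∈ , b↓) , indep , cross) closed =
    a , b , a∈ , b∈ , cross a b a∈ b∈ (differ a↑ b↓) , only
    where
    differ : ∀ {u v} → side u ≡ true → side v ≡ false → side u ≢ side v
    differ u↑ v↓ eq = case trans (sym u↑) (trans eq v↓) of λ ()

    only : ∀ c → c ∈ S → c ≡ a ⊎ c ≡ b
    only c c∈ with c ≟ᶠ a | c ≟ᶠ b | side c in c-side
    ... | yes c≡a | _       | _     = inj₁ c≡a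
    ... | no _    | yes c≡b | _     = inj₂ c≡b
    ... | no c≢a  | no _    | true  = ⊥-elim (indep c a c∈ a∈ (trans c-side (sym a↑)) c~a)
      where
      c~a : G c a
      c~a = closed c∈ b∈ a∈ (cross c b c∈ b∈ (differ c-side b↓))
                            (cross b a b∈ a∈ (differ a↑ b↓ ∘ sym)) c≢a
    ... | no _    | no c≢b  | false = ⊥-elim (indep c b c∈ b∈ (trans c-side (sym b↓)) c~b)
      where
      c~b : G c b
      c~b = closed c∈ a∈ b∈ (cross c a c∈ a∈ (differ a↑ c-side ∘ sym))
                            (cross a b a∈ b∈ (differ a↑ b↓)) c≢b

  ｛_,_,_｝ : Fin n → Fin n → Fin n → VSet n
  ｛ a , b , c ｝ v = does (v ≟ᶠ a) ∨ does (v ≟ᶠ b) ∨ does (v ≟ᶠ c)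

  ∈-｛｝⁻ : ∀ {a b c v} → v ∈ ｛ a , b , c ｝ → v ≡ a ⊎ v ≡ b ⊎ v ≡ c
  ∈-｛｝⁻ {a} {b} {c} {v} v∈ with v ≟ᶠ a | v ≟ᶠ b | v ≟ᶠ c
  ... | yes v≡a | _       | _       = inj₁ v≡a
  ... | no _    | yes v≡b | _       = inj₂ (inj₁ v≡b)
  ... | no _    | no _    | yes v≡c = inj₂ (inj₂ v≡c)
  ... | no _    | no _    | no _    = ⊥-elim v∈

  ∈-｛｝⁺ : ∀ {a b c v} → v ≡ a ⊎ v ≡ b ⊎ v ≡ c → v ∈ ｛ a , b , c ｝
  ∈-｛｝⁺ {a} {b} {c} {v} v≡ with v ≟ᶠ a | v ≟ᶠ b | v ≟ᶠ c
  ... | yes _   | _       | _       = _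
  ... | no _    | yes _   | _       = _
  ... | no _    | no _    | yes _   = _
  ... | no v≢a  | no v≢b  | no v≢c  = [ v≢a , [ v≢b , v≢c ]′ ]′ v≡

  module _ (G-sym : ∀ {u v} → G u v → G v u) (G-irrefl : ∀ {u} → ¬ G u u) where

    star-completeBipartite : ∀ {a b c} → G a b → G a c → ¬ G b c →
                             InducesCompleteBipartite G ｛ a , b , c ｝
    star-completeBipartite {a} {b} {c} ab ac ¬bc =
      (λ v → does (v ≟ᶠ a)) ,
      (a , ∈-｛｝⁺ {a} {b} {c} (inj₁ refl) , dec-true (a ≟ᶠ a) refl) ,
      (b , ∈-｛｝⁺ {a} {b} {c} (inj₂ (inj₁ refl)) ,
           dec-false (b ≟ᶠ a) λ b≡a → G-irrefl (subst (G a) b≡a ab)) ,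
      indep , cross
      where
      OneOf : Fin n → Set
      OneOf v = v ≡ a ⊎ v ≡ b ⊎ v ≡ c

      leaf : ∀ {v} → OneOf v → v ≢ a → v ≡ b ⊎ v ≡ c
      leaf v≡ v≢a = [ (λ v≡a → contradiction v≡a v≢a) , id ]′ v≡

      leaves-independent : ∀ {u v} → u ≡ b ⊎ u ≡ c → v ≡ b ⊎ v ≡ c → ¬ G u v
      leaves-independent (inj₁ refl) (inj₁ refl) = G-irrefl
      leaves-independent (inj₁ refl) (inj₂ refl) = ¬bc
      leaves-independent (inj₂ refl) (inj₁ refl) = ¬bc ∘ G-sym
      leaves-independent (inj₂ refl) (inj₂ refl) = G-irrefl

      centre-adjacent : ∀ {v} → v ≡ b ⊎ v ≡ c → G a v
      centre-adjacent (inj₁ refl) = ab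
      centre-adjacent (inj₂ refl) = ac

      same-side⇒¬adjacent : ∀ {u v} (u≟a : Dec (u ≡ a)) (v≟a : Dec (v ≡ a)) →
                            OneOf u → OneOf v → does u≟a ≡ does v≟a → ¬ G u v
      same-side⇒¬adjacent (yes u≡a) (yes v≡a) _  _  _ = G-irrefl ∘ subst (G _) (trans v≡a (sym u≡a))
      same-side⇒¬adjacent (no u≢a)  (no v≢a)  u≡ v≡ _ = leaves-independent (leaf u≡ u≢a) (leaf v≡ v≢a)
      same-side⇒¬adjacent (yes _)   (no _)    _  _  ()
      same-side⇒¬adjacent (no _)    (yes _)   _  _  ()

      opposite-sides⇒adjacent : ∀ {u v} (u≟a : Dec (u ≡ a)) (v≟a : Dec (v ≡ a)) →
                                OneOf u → OneOf v → does u≟a ≢ does v≟a → G u v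
      opposite-sides⇒adjacent (yes u≡a) (no v≢a) _  v≡ _ =
        subst (λ x → G x _) (sym u≡a) (centre-adjacent (leaf v≡ v≢a))
      opposite-sides⇒adjacent (no u≢a) (yes v≡a) u≡ _  _ =
        subst (G _) (sym v≡a) (G-sym (centre-adjacent (leaf u≡ u≢a)))
      opposite-sides⇒adjacent (yes _) (yes _) _ _ neq = contradiction refl neq
      opposite-sides⇒adjacent (no _)  (no _)  _ _ neq = contradiction refl neq

      indep : ∀ u v → u ∈ ｛ a , b , c ｝ → v ∈ ｛ a , b , c ｝ →
              does (u ≟ᶠ a) ≡ does (v ≟ᶠ a) → ¬ G u v
      indep u v u∈ v∈ = same-side⇒¬adjacent (u ≟ᶠ a) (v ≟ᶠ a) (∈-｛｝⁻ u∈) (∈-｛｝⁻ v∈)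

      cross : ∀ u v → u ∈ ｛ a , b , c ｝ → v ∈ ｛ a , b , c ｝ →
              does (u ≟ᶠ a) ≢ does (v ≟ᶠ a) → G u v
      cross u v u∈ v∈ = opposite-sides⇒adjacent (u ≟ᶠ a) (v ≟ᶠ a) (∈-｛｝⁻ u∈) (∈-｛｝⁻ v∈)

    edge-notBiclique : ∀ {S a b w} → G a b → G w a → ¬ G w b → w ≢ b →
                       a ∈ S → b ∈ S → (∀ c → c ∈ S → c ≡ a ⊎ c ≡ b) → ¬ Biclique G S
    edge-notBiclique {S} {a} {b} {w} ab wa ¬wb w≢b a∈ b∈ only (_ , maximal) =
      [ w≢a , w≢b ]′ (only w (maximal ｛ a , b , w ｝ S⊆ star w w∈))
      where
      S⊆ : S ⊆ ｛ a , b , w ｝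
      S⊆ c c∈ = ∈-｛｝⁺ ([ inj₁ , inj₂ ∘ inj₁ ]′ (only c c∈))

      star : InducesCompleteBipartite G ｛ a , b , w ｝
      star = star-completeBipartite ab (G-sym wa) (¬wb ∘ G-sym)

      w∈ : w ∈ ｛ a , b , w ｝
      w∈ = ∈-｛｝⁺ {a} {b} {w} (inj₂ (inj₂ refl))

      w≢a : w ≢ a
      w≢a refl = G-irrefl wa

    biclique-colouring :
      ∀ {c} (col : Fin n → Fin c) →
      (∀ {u v w} → G u v → G v w → u ≢ w → col u ≡ col v → col v ≡ col w → G u w) →
      (∀ {u v} → G u v → ∃[ w ] (G w u × ¬ G w v × w ≢ v)) →
      IsBicliqueColouring G col
    biclique-colouring col closed privateNeighbour S S-biclique@(icb@(_ , (x , x∈ , _) , _) , _)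
      with any? (λ v → T? (S v) ×-dec ¬? (col v ≟ᶠ col x))
    ... | yes (v , v∈ , v≢x) = v , x , v∈ , x∈ , v≢x
    ... | no ¬mixed =
      let a , b , a∈ , b∈ , ab , only = completeBipartite⇒edge icb closedˢ
          w , wa , ¬wb , w≢b = privateNeighbour ab
      in ⊥-elim (edge-notBiclique ab wa ¬wb w≢b a∈ b∈ only S-biclique)
      where
      monochromatic : ∀ {v} → v ∈ S → col v ≡ col x
      monochromatic {v} v∈ = decidable-stable (col v ≟ᶠ col x) (λ v≢x → ¬mixed (v , v∈ , v≢x))

      same : ∀ {u v} → u ∈ S → v ∈ S → col u ≡ col v
      same u∈ v∈ = trans (monochromatic u∈) (sym (monochromatic v∈))

      closedˢ : ∀ {u v w} → u ∈ S → v ∈ S → w ∈ S → G u v → G v w → u ≢ w → G u w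
      closedˢ u∈ v∈ w∈ uv vw u≢w = closed uv vw u≢w (same u∈ v∈) (same v∈ w∈)

module Forward (n : ℕ) .{{_ : NonZero n}} where

  forward : ℕ → ℕ → ℕ
  forward i j = (j + n ∸ i) % n

  -- forward i j is the clockwise distance from v_i to v_j, and
  -- CyclePower n k u v unfolds to u ≢ v × distance (toℕ u) (toℕ v) ≤ k.
  distance : ℕ → ℕ → ℕ
  distance i j = forward i j ⊓ forward j i

  forward<n : ∀ i j → forward i j < n
  forward<n i j = m%n<n (j + n ∸ i) n

  forward-≤ : ∀ {i j} → i ≤ j → j < n → forward i j ≡ j ∸ i
  forward-≤ {i} {j} i≤j j<n = begin
    (j + n ∸ i) % n  ≡⟨ cong (_% n) (+-∸-comm n i≤j) ⟩
    (j ∸ i + n) % n  ≡⟨ [m+n]%n≡m%n (j ∸ i) n ⟩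
    (j ∸ i) % n      ≡⟨ m<n⇒m%n≡m (≤-<-trans (m∸n≤m j i) j<n) ⟩
    j ∸ i            ∎
    where open ≡-Reasoning

  forward-> : ∀ {i j} → j < i → i < n → forward i j ≡ n ∸ (i ∸ j)
  forward-> {i} {j} j<i i<n = begin
    (j + n ∸ i) % n              ≡⟨ cong (λ x → (j + n ∸ x) % n) (m+[n∸m]≡n (<⇒≤ j<i)) ⟨
    (j + n ∸ (j + (i ∸ j))) % n  ≡⟨ cong (_% n) ([m+n]∸[m+o]≡n∸o j n (i ∸ j)) ⟩
    (n ∸ (i ∸ j)) % n            ≡⟨ m<n⇒m%n≡m n∸[i∸j]<n ⟩
    n ∸ (i ∸ j)                  ∎
    where
    open ≡-Reasoning
    n∸[i∸j]<n : n ∸ (i ∸ j) < n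
    n∸[i∸j]<n = ∸-monoʳ-< (m<n⇒0<n∸m j<i) (≤-trans (m∸n≤m i j) (<⇒≤ i<n))

  forward-self : ∀ {i} → i < n → forward i i ≡ 0
  forward-self {i} i<n = trans (forward-≤ ≤-refl i<n) (n∸n≡0 i)

  <⇒forward+forward≡n : ∀ {i j} → i < j → j < n → forward i j + forward j i ≡ n
  <⇒forward+forward≡n {i} {j} i<j j<n = begin
    forward i j + forward j i  ≡⟨ cong₂ _+_ (forward-≤ (<⇒≤ i<j) j<n) (forward-> i<j j<n) ⟩
    (j ∸ i) + (n ∸ (j ∸ i))    ≡⟨ m+[n∸m]≡n (≤-trans (m∸n≤m j i) (<⇒≤ j<n)) ⟩
    n                          ∎
    where open ≡-Reasoning

  forward+forward≡n : ∀ {i j} → i < n → j < n → i ≢ j → forward i j + forward j i ≡ n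
  forward+forward≡n {i} {j} i<n j<n i≢j with <-cmp i j
  ... | tri< i<j _ _ = <⇒forward+forward≡n i<j j<n
  ... | tri≈ _ i≡j _ = contradiction i≡j i≢j
  ... | tri> _ _ j<i = trans (+-comm (forward i j) (forward j i)) (<⇒forward+forward≡n j<i i<n)

  forward-flip : ∀ {i j} → i < n → j < n → i ≢ j → forward j i ≡ n ∸ forward i j
  forward-flip {i} {j} i<n j<n i≢j = begin
    forward j i                                ≡⟨ m+n∸m≡n (forward i j) (forward j i) ⟨
    forward i j + forward j i ∸ forward i j    ≡⟨ cong (_∸ forward i j) (forward+forward≡n i<n j<n i≢j) ⟩
    n ∸ forward i j                            ∎
    where open ≡-Reasoning

  forward>0 : ∀ {i j} → i < n → j < n → i ≢ j → 0 < forward i j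
  forward>0 {i} {j} i<n j<n i≢j = n≢0⇒n>0 λ fwd≡0 →
    <-irrefl (trans (forward-flip i<n j<n i≢j) (cong (n ∸_) fwd≡0)) (forward<n j i)

  forward-trans : ∀ {i j} l → i ≤ n → j ≤ n → forward i l ≡ (forward i j + forward j l) % n
  forward-trans {i} {j} l i≤n j≤n = sym (begin
    ((j + n ∸ i) % n + (l + n ∸ j) % n) % n  ≡⟨ %-distribˡ-+ (j + n ∸ i) (l + n ∸ j) n ⟨
    ((j + n ∸ i) + (l + n ∸ j)) % n
      ≡⟨ cong₂ (λ x y → (x + y) % n) (+-∸-assoc j i≤n) (+-∸-assoc l j≤n) ⟩
    ((j + (n ∸ i)) + (l + (n ∸ j))) % n      ≡⟨ cong (_% n) (swap j (n ∸ i) l (n ∸ j)) ⟩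
    ((l + (n ∸ i)) + (j + (n ∸ j))) % n      ≡⟨ cong (λ x → (l + (n ∸ i) + x) % n) (m+[n∸m]≡n j≤n) ⟩
    ((l + (n ∸ i)) + n) % n                  ≡⟨ [m+n]%n≡m%n (l + (n ∸ i)) n ⟩
    (l + (n ∸ i)) % n                        ≡⟨ cong (_% n) (+-∸-assoc l i≤n) ⟨
    (l + n ∸ i) % n                          ∎)
    where
    open ≡-Reasoning
    swap : ∀ a b c d → (a + b) + (c + d) ≡ (c + b) + (a + d)
    swap = solve-∀

  forward-surjective : ∀ {c} (v : Fin n) → c < n → ∃[ w ] forward (toℕ w) (toℕ v) ≡ c
  forward-surjective {c} v c<n =
    let w , w<n , fwd≡c = preimage (toℕ<n v)
    in fromℕ< w<n , trans (cong (λ x → forward x (toℕ v)) (toℕ-fromℕ< w<n)) fwd≡c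
    where
    preimage : ∀ {i} → i < n → ∃[ w ] (w < n × forward w i ≡ c)
    preimage {i} i<n with c ≤? i
    ... | yes c≤i = i ∸ c , ≤-<-trans (m∸n≤m i c) i<n ,
      trans (forward-≤ (m∸n≤m i c) i<n) (m∸[m∸n]≡n c≤i)
    ... | no c≰i = w , w<n , (begin
      forward w i      ≡⟨ forward-> (m<m+n i (m<n⇒0<n∸m c<n)) w<n ⟩
      n ∸ (w ∸ i)      ≡⟨ cong (n ∸_) (m+n∸m≡n i (n ∸ c)) ⟩
      n ∸ (n ∸ c)      ≡⟨ m∸[m∸n]≡n (<⇒≤ c<n) ⟩
      c                ∎)
      where
      open ≡-Reasoning
      w = i + (n ∸ c)
      w<n : w < n
      w<n = <-≤-trans (+-monoˡ-< (n ∸ c) (≰⇒> c≰i)) (≤-reflexive (m+[n∸m]≡n (<⇒≤ c<n)))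

/-≡⇒∸< : ∀ {i j} k .{{_ : NonZero k}} → i / k ≡ j / k → j ∸ i < k
/-≡⇒∸< {i} {j} k i/k≡j/k = begin-strict
  j ∸ i            ≤⟨ ∸-monoʳ-≤ j (subst (λ q → q * k ≤ i) i/k≡j/k (m/n*n≤m i k)) ⟩
  j ∸ j / k * k    ≡⟨ m%n≡m∸m/n*n j k ⟨
  j % k            <⟨ m%n<n j k ⟩
  k                ∎
  where open ≤-Reasoning

2+/≤/⇒+< : ∀ {i j} k .{{_ : NonZero k}} → 2 + i / k ≤ j / k → i + k < j
2+/≤/⇒+< {i} {j} k gap = begin-strict
  i + k                      <⟨ +-monoˡ-< k i<[1+i/k]*k ⟩
  (k + i / k * k) + k        ≡⟨ +-comm (k + i / k * k) k ⟩
  (2 + i / k) * k            ≤⟨ *-monoˡ-≤ k gap ⟩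
  j / k * k                  ≤⟨ m/n*n≤m j k ⟩
  j                          ∎
  where
  open ≤-Reasoning
  i<[1+i/k]*k : i < k + i / k * k
  i<[1+i/k]*k = begin-strict
    i                   ≡⟨ m≡m%n+[m/n]*n i k ⟩
    i % k + i / k * k   <⟨ +-monoˡ-< (i / k * k) (m%n<n i k) ⟩
    k + i / k * k       ∎

parity : ℕ → Fin 3
parity zero          = zero
parity (suc zero)    = suc zero
parity (suc (suc m)) = parity m

parity≢2 : ∀ m → parity m ≢ suc (suc zero)
parity≢2 zero          ()
parity≢2 (suc zero)    ()
parity≢2 (suc (suc m)) = parity≢2 m

parity-suc≢ : ∀ m → parity (suc m) ≢ parity m
parity-suc≢ zero          ()
parity-suc≢ (suc zero)    ()
parity-suc≢ (suc (suc m)) = parity-suc≢ m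

parity≡⇒2+≤ : ∀ {p q} → p < q → parity p ≡ parity q → 2 + p ≤ q
parity≡⇒2+≤ {p} p<q same =
  ≤∧≢⇒< p<q λ 1+p≡q → parity-suc≢ p (trans (cong parity 1+p≡q) (sym same))

module Blocks (n k : ℕ) .{{_ : NonZero n}} .{{_ : NonZero k}} (k≤n : k ≤ n) where

  open Forward n

  block : ℕ → Maybe ℕ
  block i with n ∸ k ≤? i
  ... | yes _ = nothing
  ... | no  _ = just (i / k)

  colour : Maybe ℕ → Fin 3
  colour nothing  = suc (suc zero)
  colour (just q) = parity q

  sameBlock⇒∸≤ : ∀ {i j} → i ≤ j → j < n → block i ≡ block j → j ∸ i ≤ k
  sameBlock⇒∸≤ {i} {j} i≤j j<n same with n ∸ k ≤? i | n ∸ k ≤? j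
  ... | yes n-k≤i | yes _     = m≤n+o⇒m∸n≤o j i (begin
    j            ≤⟨ <⇒≤ j<n ⟩
    n            ≤⟨ m≤n+m∸n n k ⟩
    k + (n ∸ k)  ≤⟨ +-monoʳ-≤ k n-k≤i ⟩
    k + i        ≡⟨ +-comm k i ⟩
    i + k        ∎)
    where open ≤-Reasoning
  ... | yes n-k≤i | no n-k≰j = contradiction (≤-trans n-k≤i i≤j) n-k≰j
  ... | no _      | yes _    = case same of λ ()
  ... | no _      | no _     = <⇒≤ (/-≡⇒∸< k (just-injective same))

  sameBlock⇒distance≤ : ∀ {i j} → i < n → j < n → block i ≡ block j → distance i j ≤ k
  sameBlock⇒distance≤ {i} {j} i<n j<n same with ≤-total i j
  ... | inj₁ i≤j = ≤-trans (m⊓n≤m _ _)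
    (≤-trans (≤-reflexive (forward-≤ i≤j j<n)) (sameBlock⇒∸≤ i≤j j<n same))
  ... | inj₂ j≤i = ≤-trans (m⊓n≤n _ _)
    (≤-trans (≤-reflexive (forward-≤ j≤i i<n)) (sameBlock⇒∸≤ j≤i i<n (sym same)))

  apart⇒k<distance : ∀ {i j} → i + k < j → j + k < n → k < distance i j
  apart⇒k<distance {i} {j} i+k<j j+k<n = ⊓-glb k<forward k<backward
    where
    i<j : i < j
    i<j = ≤-<-trans (m≤m+n i k) i+k<j

    j<n : j < n
    j<n = ≤-<-trans (m≤m+n j k) j+k<n

    k<forward : k < forward i j
    k<forward = subst (k <_) (sym (forward-≤ (<⇒≤ i<j) j<n))
      (m+n≤o⇒m≤o∸n (suc k) (subst (_< j) (+-comm i k) i+k<j))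

    k<backward : k < forward j i
    k<backward = subst (k <_) (sym (forward-> i<j j<n))
      (≤-trans (m+n≤o⇒m≤o∸n (suc k) (subst (_< n) (+-comm j k) j+k<n)) (∸-monoʳ-≤ n (m∸n≤m j i)))

  distance≤∧sameColour⇒sameBlock : ∀ {i j} → i < j → j < n → distance i j ≤ k →
                                   colour (block i) ≡ colour (block j) → block i ≡ block j
  distance≤∧sameColour⇒sameBlock {i} {j} i<j j<n close same-colour with n ∸ k ≤? i | n ∸ k ≤? j
  ... | yes _     | yes _    = refl
  ... | yes n-k≤i | no n-k≰j = contradiction (≤-trans n-k≤i (<⇒≤ i<j)) n-k≰j
  ... | no _      | yes _    = contradiction same-colour (parity≢2 (i / k))
  ... | no _      | no n-k≰j with i / k ≟ j / k
  ...   | yes i/k≡j/k = cong just i/k≡j/k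
  ...   | no i/k≢j/k  = contradiction close (<⇒≱ (apart⇒k<distance i+k<j j+k<n))
    where
    i+k<j : i + k < j
    i+k<j = 2+/≤/⇒+< k (parity≡⇒2+≤ (≤∧≢⇒< (/-monoˡ-≤ k (<⇒≤ i<j)) i/k≢j/k) same-colour)

    j+k<n : j + k < n
    j+k<n = m≤o∸n⇒m+n≤o (suc j) k≤n (≰⇒> n-k≰j)

module CyclePowerColouring (n k : ℕ) .{{_ : NonZero n}} .{{_ : NonZero k}}
                           (2k+2≤n : 2 * k + 2 ≤ n) where

  open Forward n

  2+2k≤n : suc k + suc k ≤ n
  2+2k≤n = subst (_≤ n) (double k) 2k+2≤n
    where
    double : ∀ k → 2 * k + 2 ≡ suc k + suc k
    double = solve-∀

  1+k<n : suc k < n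
  1+k<n = <-≤-trans (m<m+n (suc k) z<s) 2+2k≤n

  k<n : k < n
  k<n = <-trans (n<1+n k) 1+k<n

  open Blocks n k (<⇒≤ k<n)

  infix 4 _~_
  _~_ : Fin n → Fin n → Set
  _~_ = CyclePower n k

  ~-sym : ∀ {u v : Fin n} → u ~ v → v ~ u
  ~-sym (u≢v , close) = u≢v ∘ sym , subst (_≤ k) (⊓-comm _ _) close

  ~-irrefl : ∀ {u : Fin n} → ¬ u ~ u
  ~-irrefl (u≢u , _) = u≢u refl

  colouring : Fin n → Fin 3
  colouring u = colour (block (toℕ u))

  sameBlock⇒~ : ∀ {u v : Fin n} → u ≢ v → block (toℕ u) ≡ block (toℕ v) → u ~ v
  sameBlock⇒~ {u} {v} u≢v same = u≢v , sameBlock⇒distance≤ (toℕ<n u) (toℕ<n v) same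

  ~∧sameColour⇒sameBlock : ∀ {u v : Fin n} → u ~ v → colouring u ≡ colouring v →
                           block (toℕ u) ≡ block (toℕ v)
  ~∧sameColour⇒sameBlock {u} {v} (u≢v , close) same-colour with <-cmp (toℕ u) (toℕ v)
  ... | tri< u<v _ _ = distance≤∧sameColour⇒sameBlock u<v (toℕ<n v) close same-colour
  ... | tri≈ _ u≡v _ = contradiction (toℕ-injective u≡v) u≢v
  ... | tri> _ _ v<u = sym (distance≤∧sameColour⇒sameBlock v<u (toℕ<n u)
                             (subst (_≤ k) (⊓-comm _ _) close) (sym same-colour))

  monochromatic-path-closes : ∀ {u v w : Fin n} → u ~ v → v ~ w → u ≢ w →
    colouring u ≡ colouring v → colouring v ≡ colouring w → u ~ w
  monochromatic-path-closes uv vw u≢w uv-colour vw-colour =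
    sameBlock⇒~ u≢w (trans (~∧sameColour⇒sameBlock uv uv-colour) (~∧sameColour⇒sameBlock vw vw-colour))

  forward>0⇒≢ : ∀ {u v : Fin n} → 0 < forward (toℕ u) (toℕ v) → u ≢ v
  forward>0⇒≢ {u} fwd>0 refl = <-irrefl (sym (forward-self (toℕ<n u))) fwd>0

  forward≡⇒~ : ∀ {u v : Fin n} {c} → forward (toℕ u) (toℕ v) ≡ c → 0 < c → c ≤ k → u ~ v
  forward≡⇒~ refl c>0 c≤k = forward>0⇒≢ c>0 , ≤-trans (m⊓n≤m _ _) c≤k

  forward≡1+k⇒≁ : ∀ {u v : Fin n} → forward (toℕ u) (toℕ v) ≡ suc k → ¬ u ~ v
  forward≡1+k⇒≁ {u} {v} fwd≡1+k (u≢v , close) =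
    <⇒≱ (⊓-glb (≤-reflexive (sym fwd≡1+k)) k<backward) close
    where
    k<backward : k < forward (toℕ v) (toℕ u)
    k<backward = subst (k <_)
      (sym (trans (forward-flip (toℕ<n u) (toℕ<n v) (u≢v ∘ toℕ-injective)) (cong (n ∸_) fwd≡1+k)))
      (m+n≤o⇒m≤o∸n (suc k) 2+2k≤n)

  forward-via : ∀ {u v w : Fin n} {a b} →
                forward (toℕ u) (toℕ v) ≡ a → forward (toℕ v) (toℕ w) ≡ b →
                a + b ≡ suc k → forward (toℕ u) (toℕ w) ≡ suc k
  forward-via {u} {v} {w} {a} {b} fwd-uv fwd-vw a+b≡1+k = begin
    forward (toℕ u) (toℕ w)
      ≡⟨ forward-trans (toℕ w) (<⇒≤ (toℕ<n u)) (<⇒≤ (toℕ<n v)) ⟩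
    (forward (toℕ u) (toℕ v) + forward (toℕ v) (toℕ w)) % n
      ≡⟨ cong₂ (λ x y → (x + y) % n) fwd-uv fwd-vw ⟩
    (a + b) % n
      ≡⟨ cong (_% n) a+b≡1+k ⟩
    suc k % n
      ≡⟨ m<n⇒m%n≡m 1+k<n ⟩
    suc k ∎
    where open ≡-Reasoning

  -- With e the forward distance from u to v (resp. from v to u), the private neighbour w is
  -- placed k + 1 − e steps before (resp. after) u, which puts it exactly k + 1 steps from v.
  private-neighbour-behind : ∀ {u v : Fin n} → u ≢ v → forward (toℕ u) (toℕ v) ≤ k →
                             ∃[ w ] (w ~ u × ¬ w ~ v × w ≢ v)
  private-neighbour-behind {u} {v} u≢v e≤k =
    let w , fwd-wu = forward-surjective u c<n
        fwd-wv = forward-via {w} {u} {v} fwd-wu refl (m∸n+n≡m (m≤n⇒m≤1+n e≤k))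
    in w , forward≡⇒~ {w} {u} fwd-wu c>0 c≤k ,
       forward≡1+k⇒≁ {w} {v} fwd-wv , forward>0⇒≢ {w} {v} (subst (0 <_) (sym fwd-wv) z<s)
    where
    e = forward (toℕ u) (toℕ v)
    c = suc k ∸ e
    c>0 : 0 < c
    c>0 = m<n⇒0<n∸m (s≤s e≤k)
    c≤k : c ≤ k
    c≤k = ∸-monoʳ-≤ (suc k) (forward>0 (toℕ<n u) (toℕ<n v) (u≢v ∘ toℕ-injective))
    c<n : c < n
    c<n = ≤-<-trans c≤k k<n

  private-neighbour-ahead : ∀ {u v : Fin n} → u ≢ v → forward (toℕ v) (toℕ u) ≤ k →
                            ∃[ w ] (w ~ u × ¬ w ~ v × w ≢ v)
  private-neighbour-ahead {u} {v} u≢v e≤k =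
    let w , fwd-wu = forward-surjective u (∸-monoʳ-< c>0 (<⇒≤ c<n))
        w≢u = forward>0⇒≢ {w} {u} (subst (0 <_) (sym fwd-wu) (m<n⇒0<n∸m c<n))
        fwd-uw = trans (forward-flip (toℕ<n w) (toℕ<n u) (w≢u ∘ toℕ-injective))
                       (trans (cong (n ∸_) fwd-wu) (m∸[m∸n]≡n (<⇒≤ c<n)))
        fwd-vw = forward-via {v} {u} {w} refl fwd-uw (m+[n∸m]≡n (m≤n⇒m≤1+n e≤k))
    in w , ~-sym (forward≡⇒~ {u} {w} fwd-uw c>0 c≤k) ,
       forward≡1+k⇒≁ {v} {w} fwd-vw ∘ ~-sym ,
       forward>0⇒≢ {v} {w} (subst (0 <_) (sym fwd-vw) z<s) ∘ sym
    where
    e = forward (toℕ v) (toℕ u)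
    c = suc k ∸ e
    c>0 : 0 < c
    c>0 = m<n⇒0<n∸m (s≤s e≤k)
    c≤k : c ≤ k
    c≤k = ∸-monoʳ-≤ (suc k) (forward>0 (toℕ<n v) (toℕ<n u) (u≢v ∘ sym ∘ toℕ-injective))
    c<n : c < n
    c<n = ≤-<-trans c≤k k<n

  private-neighbour : ∀ {u v : Fin n} → u ~ v → ∃[ w ] (w ~ u × ¬ w ~ v × w ≢ v)
  private-neighbour {u} {v} (u≢v , close)
    with ≤-total (forward (toℕ u) (toℕ v)) (forward (toℕ v) (toℕ u))
  ... | inj₁ behind = private-neighbour-behind u≢v (subst (_≤ k) (m≤n⇒m⊓n≡m behind) close)
  ... | inj₂ ahead  = private-neighbour-ahead u≢v (subst (_≤ k) (m≥n⇒m⊓n≡n ahead) close)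

theorem5 : (n k : ℕ) → 1 ≤ k → 2 * k + 2 ≤ n → .{{_ : NonZero n}} →
    BicliqueChromatic≤ (CyclePower n k) 3
theorem5 n k 1≤k 2k+2≤n =
  colouring , biclique-colouring ~-sym ~-irrefl colouring monochromatic-path-closes private-neighbour
  where
  instance
    k≢0 : NonZero k
    k≢0 = >-nonZero 1≤k
  open CyclePowerColouring n k 2k+2≤n
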